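{- For every PCF term $t$ of type $\iota$, there is a logical equivalence \[\mathrm{isdefined}([\![t]\!])\longleftrightarrow \exists_{n:\mathbb N}\exists_{k:\mathbb N}\ t\leadsto^k\underline n.\] Moreover, for all $n,k:\mathbb N$, the type $t\leadsto^k\underline n$ is decidable. In particular, $\mathrm{isdefined}([\![t]\!])$ is semidecidable.
   Context: Ambient theory: intensional Martin-Löf type theory with function extensionality, propositional extensionality and propositional truncation $\|-\|$. There are universes $\mathcal U_0:\mathcal U_1$, and $\Omega$ is the type of propositions in $\mathcal U_0$. We write $\exists_{x:X}Y(x):=\|\sum_{x:X}Y(x)\|$. A type $Y$ is decidable if $Y+\neg Y$ holds. PCF types are $\iota$ and $\sigma\Rightarrow\tau$. PCF terms are generated inductively by the following constants and application: - $\mathsf{zero}:\iota$; - $\mathsf{succ},\mathsf{pred}:\iota\Rightarrow\iota$; - $\mathsf{ifz}:\iota\Rightarrow\iota\Rightarrow\iota\Rightarrow\iota$; - $\mathsf k_{\sigma,\tau}:\sigma\Rightarrow\tau\Rightarrow\sigma$; - $\mathsf s_{\sigma,\tau,\rho}:(\sigma\Rightarrow\tau\Rightarrow\rho)\Rightarrow(\sigma\Rightarrow\tau)\Rightarrow\sigma\Rightarrow\rho$; - $\mathsf{fix}_\sigma:(\sigma\Rightarrow\sigma)\Rightarrow\sigma$; - application $st$. Numerals: $\underline0=\mathsf{zero}$ and $\underline{n+1}=\mathsf{succ}\,\underline n$. The relation $\tilde\leadsto$ is the inductive family generated by: - $\mathsf{pred}\,\underline0\tilde\leadsto\underline0$;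 - $\mathsf{pred}\,\underline{n+1}\tilde\leadsto\underline n$; - $\mathsf{ifz}\,s\,t\,\underline0\tilde\leadsto s$; - $\mathsf{ifz}\,s\,t\,\underline{n+1}\tilde\leadsto t$; - $\mathsf kst\tilde\leadsto s$; - $\mathsf sfgt\tilde\leadsto ft(gt)$; - $\mathsf{fix}\,f\tilde\leadsto f(\mathsf{fix}\,f)$; - if $f\tilde\leadsto g$ then $ft\tilde\leadsto gt$; - congruence under $\mathsf{succ}$ and $\mathsf{pred}$; - congruence in the last argument of $\mathsf{ifz}$. Set $s\leadsto t:=\|s\tilde\leadsto t\|$. For a relation $R$, define $xR_0y:=(x=y)$ and $xR_{k+1}z:=\sum_y xRy\times yR_kz$, and $xR^ky:=\|xR_ky\|$. Then $\leadsto^k$ is this construction applied to $\leadsto$. Semantics. The lifting is $\mathcal L(X)=\sum_{P:\Omega}(P\to X)$ with $\mathrm{isdefined}=\mathsf{pr}_1$ and $\mathrm{value}(P,\varphi)(p)=\varphi(p)$. We write $\eta(x)=(\mathbf 1,\lambda t.x)$ and $\bot=(\mathbf 0,!)$. The order is $l\sqsubseteq m:=(\mathrm{isdefined}(l)\to l=m)$, and directed suprema are $(\|\sum_i\mathrm{isdefined}(u_i)\|,\phi)$. $[\![\iota]\!]=\mathcal L(\mathbb N)$, and $[\![\sigma\Rightarrow\tau]\!]$ is the dcpo with $\bot$ of continuous maps with the pointwise order. Interpretation of terms: - $[\![\mathsf{zero}]\!]=\eta(0)$; - $[\![\mathsf{succ}]\!]=\mathcal L(\mathrm{succ})$ and $[\![\mathsf{pred}]\!]=\mathcal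 L(\mathrm{pred})$, where $\mathcal L(f)(P,\varphi)=(P,f\circ\varphi)$; - $[\![\mathsf{ifz}]\!]=\lambda x,y.(\chi_{x,y})^\#$, where $\chi_{x,y}(0)=x$, $\chi_{x,y}(n+1)=y$, and $g^\#(P,\varphi)=(\sum_{p:P}\mathrm{isdefined}(g(\varphi p)),(p,d)\mapsto\mathrm{value}(g(\varphi p))(d))$; - $[\![\mathsf k]\!]=\lambda x,y.x$; - $[\![\mathsf s]\!]=\lambda f,g,x.f(x)(g(x))$; - $[\![\mathsf{fix}]\!](f)=\bigsqcup_n f^n(\bot)$; - $[\![st]\!]=[\![s]\!]([\![t]\!])$. -}

module Defs where

open import Level using (Level; _⊔_; Setω)
open import Data.Nat using (ℕ; zero; suc; _+_)
open import Data.Nat.Properties using (+-comm) renaming (≡-irrelevant to ℕ-isSet)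
open import Data.Product using (Σ; _×_; _,_; proj₁; proj₂)
open import Data.Sum using (_⊎_)
open import Data.Empty renaming (⊥ to 𝟘)
open import Data.Unit using (⊤; tt)
open import Data.Bool using (Bool; true)
open import Relation.Nullary using (¬_)
open import Relation.Binary.PropositionalEquality using (_≡_; refl; sym; trans; cong; cong₂; subst)
open import Function.Bundles using (_⇔_)
open import Axiom.Extensionality.Propositional using (Extensionality; implicit-extensionality)
import Axiom.UniquenessOfIdentityProofs as UIP

isProp : ∀ {ℓ} → Set ℓ → Set ℓ
isProp A = (x y : A) → x ≡ y

isSet : ∀ {ℓ} → Set ℓ → Set ℓ
isSet A = (x y : A) → isProp (x ≡ y)

FunExt : Setω
FunExt = ∀ {a b} → Extensionality a b

PropExt : Set₁
PropExt = {P Q : Set} → isProp P → isProp Q → (P → Q) → (Q → P) → P ≡ Q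

record PropTrunc : Setω where
  field
    ∥_∥ : ∀ {ℓ} → Set ℓ → Set ℓ
    ∣_∣ : ∀ {ℓ} {A : Set ℓ} → A → ∥ A ∥
    ∥∥-isProp : ∀ {ℓ} {A : Set ℓ} → isProp ∥ A ∥
    ∥∥-rec : ∀ {ℓ ℓ'} {A : Set ℓ} {B : Set ℓ'} → isProp B → (A → B) → ∥ A ∥ → B

infixr 30 _⇒_
data Ty : Set where
  ι   : Ty
  _⇒_ : Ty → Ty → Ty

infixl 40 _·_
data Tm : Ty → Set where
  ZERO : Tm ι
  SUCC : Tm (ι ⇒ ι)
  PRED : Tm (ι ⇒ ι)
  IFZ  : Tm (ι ⇒ ι ⇒ ι ⇒ ι)
  K    : {σ τ : Ty} → Tm (σ ⇒ τ ⇒ σ)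
  S    : {σ τ ρ : Ty} → Tm ((σ ⇒ τ ⇒ ρ) ⇒ (σ ⇒ τ) ⇒ σ ⇒ ρ)
  FIX  : {σ : Ty} → Tm ((σ ⇒ σ) ⇒ σ)
  _·_  : {σ τ : Ty} → Tm (σ ⇒ τ) → Tm σ → Tm τ

numeral : ℕ → Tm ι
numeral zero    = ZERO
numeral (suc n) = SUCC · numeral n

-- the inductive (untruncated) one-step reduction  s ~̃> t
infix 4 _⇝ᵢ_
data _⇝ᵢ_ : {σ : Ty} → Tm σ → Tm σ → Set where
  pred-zero : PRED · numeral zero ⇝ᵢ numeral zero
  pred-suc  : (n : ℕ) → PRED · numeral (suc n) ⇝ᵢ numeral n
  ifz-zero  : (s t : Tm ι) → IFZ · s · t · numeral zero ⇝ᵢ s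
  ifz-suc   : (s t : Tm ι) (n : ℕ) → IFZ · s · t · numeral (suc n) ⇝ᵢ t
  k-β       : {σ τ : Ty} (s : Tm σ) (t : Tm τ) → K · s · t ⇝ᵢ s
  s-β       : {σ τ ρ : Ty} (f : Tm (σ ⇒ τ ⇒ ρ)) (g : Tm (σ ⇒ τ)) (t : Tm σ) →
              S · f · g · t ⇝ᵢ f · t · (g · t)
  fix-β     : {σ : Ty} (f : Tm (σ ⇒ σ)) → FIX · f ⇝ᵢ f · (FIX · f)
  app-cong  : {σ τ : Ty} {f g : Tm (σ ⇒ τ)} (t : Tm σ) → f ⇝ᵢ g → f · t ⇝ᵢ g · t
  succ-cong : {s t : Tm ι} → s ⇝ᵢ t → SUCC · s ⇝ᵢ SUCC · t
  pred-cong : {s t : Tm ι} → s ⇝ᵢ t → PRED · s ⇝ᵢ PRED · t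
  ifz-cong  : (r r' : Tm ι) {s t : Tm ι} → s ⇝ᵢ t → IFZ · r · r' · s ⇝ᵢ IFZ · r · r' · t

iterRel : ∀ {ℓ} {A : Set ℓ} → (A → A → Set ℓ) → ℕ → A → A → Set ℓ
iterRel R zero    x y = x ≡ y
iterRel R (suc k) x z = Σ _ (λ y → R x y × iterRel R k y z)

Ω : Set₁
Ω = Σ Set isProp

𝓛 : Set → Set₁
𝓛 X = Σ Ω (λ P → proj₁ P → X)

isdefined : {X : Set} → 𝓛 X → Set
isdefined l = proj₁ (proj₁ l)

isdefined-isProp : {X : Set} (l : 𝓛 X) → isProp (isdefined l)
isdefined-isProp l = proj₂ (proj₁ l)

value : {X : Set} (l : 𝓛 X) → isdefined l → X
value l = proj₂ l

η : {X : Set} → X → 𝓛 X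
η x = ((⊤ , λ _ _ → refl) , λ _ → x)

⊥ₗ : {X : Set} → 𝓛 X
⊥ₗ = ((𝟘 , λ ()) , λ ())

infix 4 _⊑ₗ_
_⊑ₗ_ : {X : Set} → 𝓛 X → 𝓛 X → Set₁
l ⊑ₗ m = isdefined l → l ≡ m

𝓛map : {X Y : Set} → (X → Y) → 𝓛 X → 𝓛 Y
𝓛map f l = (proj₁ l , λ p → f (proj₂ l p))

Σ-isProp : {A : Set} {B : A → Set} → isProp A → ((a : A) → isProp (B a)) → isProp (Σ A B)
Σ-isProp pA pB (a , b) (a' , b') with pA a a'
... | refl = cong (a ,_) (pB a b b')

_♯ : {X Y : Set} → (X → 𝓛 Y) → 𝓛 X → 𝓛 Y
(g ♯) l = ((Σ (isdefined l) (λ p → isdefined (g (value l p))) ,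
            Σ-isProp (isdefined-isProp l) (λ p → isdefined-isProp (g (value l p)))) ,
           λ pd → value (g (value l (proj₁ pd))) (proj₂ pd))

χ : {A : Set₁} → A → A → ℕ → A
χ x y zero    = x
χ x y (suc n) = y

module Model (pt : PropTrunc) (fe : FunExt) (pe : PropExt) where
  open PropTrunc pt public

  ∃ᵗ : ∀ {a b} {A : Set a} → (A → Set b) → Set (a ⊔ b)
  ∃ᵗ {A = A} B = ∥ Σ A B ∥

  ∥∥-map : ∀ {a b} {A : Set a} {B : Set b} → (A → B) → ∥ A ∥ → ∥ B ∥
  ∥∥-map f = ∥∥-rec ∥∥-isProp (λ a → ∣ f a ∣)

  infix 4 _⇝_
  _⇝_ : {σ : Ty} → Tm σ → Tm σ → Set
  s ⇝ t = ∥ s ⇝ᵢ t ∥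

  _^_ : ∀ {ℓ} {A : Set ℓ} → (A → A → Set ℓ) → ℕ → A → A → Set ℓ
  (R ^ k) x y = ∥ iterRel R k x y ∥

  isSemidecidable : Set → Set
  isSemidecidable X = ∃ᵗ (λ (α : ℕ → Bool) → X ⇔ ∃ᵗ (λ n → α n ≡ true))

  cong₃ : ∀ {a b c d} {A : Set a} {B : Set b} {C : Set c} {D : Set d} (f : A → B → C → D)
          {x x' : A} {y y' : B} {z z' : C} → x ≡ x' → y ≡ y' → z ≡ z' → f x y z ≡ f x' y' z'
  cong₃ f refl refl refl = refl

  isProp→isSet : ∀ {ℓ} {A : Set ℓ} → isProp A → isSet A
  isProp→isSet {A = A} h x y = UIP.Constant⇒UIP.≡-irrelevant {A = A} f fc
    where
    f : {x y : A} → x ≡ y → x ≡ y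
    f {x} {y} _ = trans (sym (h x x)) (h x y)
    fc : {x y : A} (p q : x ≡ y) → f p ≡ f q
    fc _ _ = refl

  isProp-isProp : ∀ {ℓ} {A : Set ℓ} → isProp (isProp A)
  isProp-isProp h h' = fe (λ x → fe (λ y → isProp→isSet h x y (h x y) (h' x y)))

  Π-isProp : ∀ {a b} {A : Set a} {B : A → Set b} → ((x : A) → isProp (B x)) → isProp ((x : A) → B x)
  Π-isProp h f g = fe (λ x → h x (f x) (g x))

  Πi-isProp : ∀ {a b} {A : Set a} {B : A → Set b} → ((x : A) → isProp (B x)) → isProp ({x : A} → B x)
  Πi-isProp h f g = implicit-extensionality fe (λ {x} → h x f g)

  isDirected : {C : Set₁} (_⊑_ : C → C → Set₁) {I : Set} → (I → C) → Set₁
  isDirected _⊑_ {I} α = ∥ I ∥ × ((i j : I) → ∃ᵗ (λ k → (α i ⊑ α k) × (α j ⊑ α k)))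

  record DCPO⊥ : Set₂ where
    field
      Carrier   : Set₁
      _⊑_       : Carrier → Carrier → Set₁
      ⊑-prop    : (x y : Carrier) → isProp (x ⊑ y)
      ⊑-refl    : (x : Carrier) → x ⊑ x
      ⊑-trans   : (x y z : Carrier) → x ⊑ y → y ⊑ z → x ⊑ z
      ⊑-antisym : (x y : Carrier) → x ⊑ y → y ⊑ x → x ≡ y
      ⊥         : Carrier
      ⊥-least   : (x : Carrier) → ⊥ ⊑ x
      ∐         : {I : Set} (α : I → Carrier) → isDirected _⊑_ α → Carrier
      ∐-upper   : {I : Set} (α : I → Carrier) (δ : isDirected _⊑_ α) (i : I) → α i ⊑ ∐ α δ
      ∐-least   : {I : Set} (α : I → Carrier) (δ : isDirected _⊑_ α) (u : Carrier) →
                  ((i : I) → α i ⊑ u) → ∐ α δ ⊑ u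

  open DCPO⊥

  record ContMap (D E : DCPO⊥) : Set₁ where
    constructor cmap
    field
      fun  : Carrier D → Carrier E
      mono : (x y : Carrier D) → _⊑_ D x y → _⊑_ E (fun x) (fun y)
      cont : {I : Set} (α : I → Carrier D) (δ : isDirected (_⊑_ D) α) (u : Carrier E) →
             ((i : I) → _⊑_ E (fun (α i)) u) → _⊑_ E (fun (∐ D α δ)) u

  open ContMap

  value-cong : {X : Set} {l m : 𝓛 X} (e : l ≡ m) (d : isdefined l) (d' : isdefined m) →
               value l d ≡ value m d'
  value-cong {l = l} refl d d' = cong (value l) (isdefined-isProp l d d')

  private
    𝓛-eq' : {X : Set} {P Q : Set} (e : P ≡ Q) (pP : isProp P) (pQ : isProp Q)
            (φ : P → X) (ψ : Q → X) → ((d : P) → φ d ≡ ψ (subst (λ A → A) e d)) →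
            _≡_ {A = 𝓛 X} ((P , pP) , φ) ((Q , pQ) , ψ)
    𝓛-eq' refl pP pQ φ ψ h = cong₂ (λ a b → ((_ , a) , b)) (isProp-isProp pP pQ) (fe h)

  𝓛-ext : {X : Set} (l m : 𝓛 X) → (isdefined l → isdefined m) → (isdefined m → isdefined l) →
          ((d : isdefined l) (e : isdefined m) → value l d ≡ value m e) → l ≡ m
  𝓛-ext ((P , pP) , φ) ((Q , pQ) , ψ) f g h =
    𝓛-eq' (pe pP pQ f g) pP pQ φ ψ (λ d → h d _)

  𝓛ℕ-isSet : isSet (𝓛 ℕ)
  𝓛ℕ-isSet _ _ = UIP.Constant⇒UIP.≡-irrelevant {A = 𝓛 ℕ} c cc
    where
    F : {l m : 𝓛 ℕ} → l ≡ m → isdefined l → isdefined m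
    F e d = subst isdefined e d
    G : {l m : 𝓛 ℕ} → l ≡ m → isdefined m → isdefined l
    G e d = subst isdefined (sym e) d
    H : {l m : 𝓛 ℕ} (e : l ≡ m) (d : isdefined l) (d' : isdefined m) → value l d ≡ value m d'
    H e d d' = value-cong e d d'
    c : {l m : 𝓛 ℕ} → l ≡ m → l ≡ m
    c {l} {m} e = 𝓛-ext l m (F e) (G e) (H e)
    cc : {l m : 𝓛 ℕ} (p q : l ≡ m) → c p ≡ c q
    cc {l} {m} p q =
      cong₃ (𝓛-ext l m)
            (Π-isProp (λ _ → isdefined-isProp m) (F p) (F q))
            (Π-isProp (λ _ → isdefined-isProp l) (G p) (G q))
            (Π-isProp (λ _ → Π-isProp (λ _ → ℕ-isSet)) (H p) (H q))

  ⊑ₗ-prop : (l m : 𝓛 ℕ) → isProp (l ⊑ₗ m)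
  ⊑ₗ-prop l m = Π-isProp (λ _ → 𝓛ℕ-isSet l m)

  private
    Img : {A : Set} → (A → ℕ) → Set
    Img {A} f = Σ ℕ (λ n → ∥ Σ A (λ a → f a ≡ n) ∥)

    Img-isProp : {A : Set} (f : A → ℕ) → ((a b : A) → f a ≡ f b) → isProp (Img f)
    Img-isProp f c (n , p) (n' , p') = lemma e p p'
      where
      e : n ≡ n'
      e = ∥∥-rec ℕ-isSet (λ ap → ∥∥-rec ℕ-isSet (λ ap' →
            trans (sym (proj₂ ap)) (trans (c (proj₁ ap) (proj₁ ap')) (proj₂ ap'))) p') p
      lemma : {m m' : ℕ} (e : m ≡ m') (q : ∥ Σ _ (λ a → f a ≡ m) ∥) (q' : ∥ Σ _ (λ a → f a ≡ m') ∥) →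
              _≡_ {A = Img f} (m , q) (m' , q')
      lemma refl q q' = cong (_ ,_) (∥∥-isProp q q')

  factor : {A : Set} (f : A → ℕ) → ((a b : A) → f a ≡ f b) → ∥ A ∥ → ℕ
  factor f c t = proj₁ (∥∥-rec (Img-isProp f c) (λ a → f a , ∣ a , refl ∣) t)

  factor-β : {A : Set} (f : A → ℕ) (c : (a b : A) → f a ≡ f b) (t : ∥ A ∥) (a : A) → factor f c t ≡ f a
  factor-β f c t a = ∥∥-rec ℕ-isSet (λ ap → trans (sym (proj₂ ap)) (c (proj₁ ap) a)) (proj₂ im)
    where
    im = ∥∥-rec (Img-isProp f c) (λ a → f a , ∣ a , refl ∣) t

  private
    sup-const : {I : Set} (α : I → 𝓛 ℕ) → isDirected _⊑ₗ_ α →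
                (a b : Σ I (λ i → isdefined (α i))) →
                value (α (proj₁ a)) (proj₂ a) ≡ value (α (proj₁ b)) (proj₂ b)
    sup-const α δ (i , d) (j , e) = ∥∥-rec ℕ-isSet step (proj₂ δ i j)
      where
      step : Σ _ (λ k → (α i ⊑ₗ α k) × (α j ⊑ₗ α k)) → value (α i) d ≡ value (α j) e
      step (k , p , q) = trans (value-cong (p d) d (subst isdefined (p d) d))
                               (sym (value-cong (q e) e (subst isdefined (p d) d)))

  ∐ₗ : {I : Set} (α : I → 𝓛 ℕ) → isDirected _⊑ₗ_ α → 𝓛 ℕ
  ∐ₗ α δ = ((∥ Σ _ (λ i → isdefined (α i)) ∥ , ∥∥-isProp) ,
            factor (λ a → value (α (proj₁ a)) (proj₂ a)) (sup-const α δ))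

  ∐ₗ-upper : {I : Set} (α : I → 𝓛 ℕ) (δ : isDirected _⊑ₗ_ α) (i : I) → α i ⊑ₗ ∐ₗ α δ
  ∐ₗ-upper α δ i d = 𝓛-ext (α i) (∐ₗ α δ) (λ d' → ∣ i , d' ∣) (λ _ → d)
    (λ d' t → sym (factor-β (λ a → value (α (proj₁ a)) (proj₂ a)) (sup-const α δ) t (i , d')))

  ∐ₗ-least : {I : Set} (α : I → 𝓛 ℕ) (δ : isDirected _⊑ₗ_ α) (u : 𝓛 ℕ) →
             ((i : I) → α i ⊑ₗ u) → ∐ₗ α δ ⊑ₗ u
  ∐ₗ-least α δ u h t = ∥∥-rec (𝓛ℕ-isSet _ _)
    (λ a → trans (sym (∐ₗ-upper α δ (proj₁ a) (proj₂ a))) (h (proj₁ a) (proj₂ a))) t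

  𝓛ℕ : DCPO⊥
  𝓛ℕ = record
    { Carrier   = 𝓛 ℕ
    ; _⊑_       = _⊑ₗ_
    ; ⊑-prop    = ⊑ₗ-prop
    ; ⊑-refl    = λ x _ → refl
    ; ⊑-trans   = λ x y z p q d → trans (p d) (q (subst isdefined (p d) d))
    ; ⊑-antisym = λ x y p q → 𝓛-ext x y (λ d → subst isdefined (p d) d)
                                         (λ d → subst isdefined (q d) d)
                                         (λ d e → value-cong (p d) d e)
    ; ⊥         = ⊥ₗ
    ; ⊥-least   = λ x ()
    ; ∐         = ∐ₗ
    ; ∐-upper   = ∐ₗ-upper
    ; ∐-least   = ∐ₗ-least
    }

  ContMap-ext : {D E : DCPO⊥} (f g : ContMap D E) → fun f ≡ fun g → f ≡ g
  ContMap-ext {D} {E} (cmap f m c) (cmap .f m' c') refl =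
    cong₂ (cmap f)
      (Π-isProp (λ x → Π-isProp (λ y → Π-isProp (λ _ → ⊑-prop E (f x) (f y)))) m m')
      (Πi-isProp (λ I → Π-isProp (λ α → Π-isProp (λ δ → Π-isProp (λ u →
         Π-isProp (λ _ → ⊑-prop E (f (∐ D α δ)) u)))))
         (λ {I} → c {I}) (λ {I} → c' {I}))

  module _ (D E : DCPO⊥) where
    infixr 30 _⟹_
    private
      _⊑ᴱ_ = _⊑_ E
      _⊑→_ : ContMap D E → ContMap D E → Set₁
      f ⊑→ g = (x : Carrier D) → fun f x ⊑ᴱ fun g x

    pointwise-dir : {I : Set} (α : I → ContMap D E) → isDirected _⊑→_ α → (x : Carrier D) →
                    isDirected _⊑ᴱ_ (λ i → fun (α i) x)
    pointwise-dir α δ x =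
      proj₁ δ , λ i j → ∥∥-map (λ kpq → proj₁ kpq , proj₁ (proj₂ kpq) x , proj₂ (proj₂ kpq) x)
                                (proj₂ δ i j)

    ∐→ : {I : Set} (α : I → ContMap D E) → isDirected _⊑→_ α → ContMap D E
    ∐→ α δ = record
      { fun  = λ x → ∐ E (λ i → fun (α i) x) (pointwise-dir α δ x)
      ; mono = λ x y p → ∐-least E _ _ _ (λ i →
                 ⊑-trans E _ _ _ (mono (α i) x y p) (∐-upper E _ (pointwise-dir α δ y) i))
      ; cont = λ β δ' u h → ∐-least E _ _ _ (λ i →
                 cont (α i) β δ' u (λ j → ⊑-trans E _ _ _ (∐-upper E _ (pointwise-dir α δ (β j)) i) (h j)))
      }

    const-map : Carrier E → ContMap D E
    const-map e = record
      { fun  = λ _ → e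
      ; mono = λ _ _ _ → ⊑-refl E e
      ; cont = λ β δ u h → ∥∥-rec (⊑-prop E e u) h (proj₁ δ)
      }

    _⟹_ : DCPO⊥
    _⟹_ = record
      { Carrier   = ContMap D E
      ; _⊑_       = _⊑→_
      ; ⊑-prop    = λ f g → Π-isProp (λ x → ⊑-prop E (fun f x) (fun g x))
      ; ⊑-refl    = λ f x → ⊑-refl E (fun f x)
      ; ⊑-trans   = λ f g h p q x → ⊑-trans E _ _ _ (p x) (q x)
      ; ⊑-antisym = λ f g p q → ContMap-ext f g (fe (λ x → ⊑-antisym E _ _ (p x) (q x)))
      ; ⊥         = const-map (⊥ E)
      ; ⊥-least   = λ f x → ⊥-least E (fun f x)
      ; ∐         = ∐→
      ; ∐-upper   = λ α δ i x → ∐-upper E _ (pointwise-dir α δ x) i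
      ; ∐-least   = λ α δ u h x → ∐-least E _ (pointwise-dir α δ x) (fun u x) (λ i → h i x)
      }


  image-dir : {D E : DCPO⊥} (f : ContMap D E) {I : Set} (α : I → Carrier D) →
              isDirected (_⊑_ D) α → isDirected (_⊑_ E) (λ i → fun f (α i))
  image-dir f α δ = proj₁ δ , λ i j → ∥∥-map
    (λ kpq → proj₁ kpq , mono f _ _ (proj₁ (proj₂ kpq)) , mono f _ _ (proj₂ (proj₂ kpq))) (proj₂ δ i j)

  ⟦_⟧ᵗ : Ty → DCPO⊥
  ⟦ ι ⟧ᵗ     = 𝓛ℕ
  ⟦ σ ⇒ τ ⟧ᵗ = ⟦ σ ⟧ᵗ ⟹ ⟦ τ ⟧ᵗ

  𝓛mapC : (ℕ → ℕ) → ContMap ⟦ ι ⟧ᵗ ⟦ ι ⟧ᵗ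
  𝓛mapC f = record
    { fun  = 𝓛map f
    ; mono = λ x y p d → cong (𝓛map f) (p d)
    ; cont = λ β δ u h d → ∥∥-rec (𝓛ℕ-isSet _ _)
               (λ ie → let E = cong (𝓛map f) (sym (∐ₗ-upper β δ (proj₁ ie) (proj₂ ie)))
                       in trans E (h (proj₁ ie) (subst isdefined E d))) d
    }

  private
    ♯' : (z : 𝓛 ℕ) → (isdefined z → 𝓛 ℕ) → 𝓛 ℕ
    ♯' z h = ((Σ (isdefined z) (λ p → isdefined (h p)) ,
               Σ-isProp (isdefined-isProp z) (λ p → isdefined-isProp (h p))) ,
              λ pd → value (h (proj₁ pd)) (proj₂ pd))

    transport-eq : {A : Set₁} (g g' : ℕ → A) {n n' : ℕ} → n' ≡ n → g n ≡ g' n → g n' ≡ g' n'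
    transport-eq g g' refl e = e

  ♯-sup : (z : 𝓛 ℕ) (g : ℕ → 𝓛 ℕ) {I : Set} (G : I → ℕ → 𝓛 ℕ) (u : 𝓛 ℕ) →
          ((i : I) → (G i ♯) z ⊑ₗ u) →
          ((n : ℕ) → isdefined (g n) → ∃ᵗ (λ i → g n ≡ G i n)) →
          (g ♯) z ⊑ₗ u
  ♯-sup z g G u h key pd = ∥∥-rec (𝓛ℕ-isSet _ _) step (key (value z (proj₁ pd)) (proj₂ pd))
    where
    step : Σ _ (λ i → g (value z (proj₁ pd)) ≡ G i (value z (proj₁ pd))) → (g ♯) z ≡ u
    step (i , e) = trans E (h i (subst isdefined E pd))
      where
      E : (g ♯) z ≡ (G i ♯) z
      E = cong (♯' z) (fe (λ p' → transport-eq g (G i)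
                                     (cong (value z) (isdefined-isProp z p' (proj₁ pd))) e))

  IfzZ : 𝓛 ℕ → 𝓛 ℕ → ContMap ⟦ ι ⟧ᵗ ⟦ ι ⟧ᵗ
  IfzZ x y = record
    { fun  = λ z → (χ x y ♯) z
    ; mono = λ z z' p pd → cong (χ x y ♯) (p (proj₁ pd))
    ; cont = λ β δ u h pd → ∥∥-rec (𝓛ℕ-isSet _ _)
               (λ ie → let E = cong (χ x y ♯) (sym (∐ₗ-upper β δ (proj₁ ie) (proj₂ ie)))
                       in trans E (h (proj₁ ie) (subst isdefined E pd))) (proj₁ pd)
    }

  IfzY : 𝓛 ℕ → ContMap ⟦ ι ⟧ᵗ ⟦ ι ⇒ ι ⟧ᵗ
  IfzY x = record
    { fun  = IfzZ x
    ; mono = λ y y' p z → ♯-sup z (χ x y) (λ (_ : ⊤) → χ x y') _ (λ _ _ → refl) (mkey y y' p)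
    ; cont = λ β δ u h z → ♯-sup z (χ x (∐ₗ β δ)) (λ i → χ x (β i)) _ (λ i → h i z) (ckey β δ)
    }
    where
    mkey : (y y' : 𝓛 ℕ) → y ⊑ₗ y' → (n : ℕ) → isdefined (χ x y n) → ∃ᵗ (λ (_ : ⊤) → χ x y n ≡ χ x y' n)
    mkey y y' p zero    d = ∣ tt , refl ∣
    mkey y y' p (suc n) d = ∣ tt , p d ∣
    ckey : {I : Set} (β : I → 𝓛 ℕ) (δ : isDirected _⊑ₗ_ β) (n : ℕ) → isdefined (χ x (∐ₗ β δ) n) →
           ∃ᵗ (λ i → χ x (∐ₗ β δ) n ≡ χ x (β i) n)
    ckey β δ zero    d = ∥∥-map (λ i → i , refl) (proj₁ δ)
    ckey β δ (suc n) d = ∥∥-map (λ ie → proj₁ ie , sym (∐ₗ-upper β δ (proj₁ ie) (proj₂ ie))) d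

  IfzX : ContMap ⟦ ι ⟧ᵗ ⟦ ι ⇒ ι ⇒ ι ⟧ᵗ
  IfzX = record
    { fun  = IfzY
    ; mono = λ x x' p y z → ♯-sup z (χ x y) (λ (_ : ⊤) → χ x' y) _ (λ _ _ → refl) (mkey x x' p y)
    ; cont = λ α δ u h y z → ♯-sup z (χ (∐ₗ α δ) y) (λ i → χ (α i) y) _ (λ i → h i y z) (ckey α δ y)
    }
    where
    mkey : (x x' : 𝓛 ℕ) → x ⊑ₗ x' → (y : 𝓛 ℕ) (n : ℕ) → isdefined (χ x y n) →
           ∃ᵗ (λ (_ : ⊤) → χ x y n ≡ χ x' y n)
    mkey x x' p y zero    d = ∣ tt , p d ∣
    mkey x x' p y (suc n) d = ∣ tt , refl ∣
    ckey : {I : Set} (α : I → 𝓛 ℕ) (δ : isDirected _⊑ₗ_ α) (y : 𝓛 ℕ) (n : ℕ) →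
           isdefined (χ (∐ₗ α δ) y n) → ∃ᵗ (λ i → χ (∐ₗ α δ) y n ≡ χ (α i) y n)
    ckey α δ y zero    d = ∥∥-map (λ ie → proj₁ ie , sym (∐ₗ-upper α δ (proj₁ ie) (proj₂ ie))) d
    ckey α δ y (suc n) d = ∥∥-map (λ i → i , refl) (proj₁ δ)

  Kc : (D E : DCPO⊥) → ContMap D (E ⟹ D)
  Kc D E = record
    { fun  = const-map E D
    ; mono = λ x x' p y → p
    ; cont = λ α δ u h y → ∐-least D α δ (fun u y) (λ i → h i y)
    }

  module _ (A B C : DCPO⊥) where
    S3 : ContMap A (B ⟹ C) → ContMap A B → ContMap A C
    S3 f g = record
      { fun  = λ x → fun (fun f x) (fun g x)
      ; mono = λ x y p → ⊑-trans C _ _ _ (mono (fun f x) _ _ (mono g x y p)) (mono f x y p (fun g y))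
      ; cont = cont'
      }
      where
      cont' : {I : Set} (α : I → Carrier A) (δ : isDirected (_⊑_ A) α) (u : Carrier C) →
              ((i : I) → _⊑_ C (fun (fun f (α i)) (fun g (α i))) u) →
              _⊑_ C (fun (fun f (∐ A α δ)) (fun g (∐ A α δ))) u
      cont' {I} α δ u h = ⊑-trans C _ _ _ (mono (fun f (∐ A α δ)) _ _ step1)
                        (cont (fun f (∐ A α δ)) (λ j → fun g (α j)) gδ u step3)
        where
        gδ = image-dir g α δ
        fδ = image-dir f α δ
        step1 : _⊑_ B (fun g (∐ A α δ)) (∐ B (λ i → fun g (α i)) gδ)
        step1 = cont g α δ _ (λ i → ∐-upper B _ gδ i)
        step4 : (i j : I) → _⊑_ C (fun (fun f (α i)) (fun g (α j))) u
        step4 i j = ∥∥-rec (⊑-prop C _ _)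
          (λ kpq → ⊑-trans C _ _ _ (mono f _ _ (proj₁ (proj₂ kpq)) (fun g (α j)))
                     (⊑-trans C _ _ _ (mono (fun f (α (proj₁ kpq))) _ _ (mono g _ _ (proj₂ (proj₂ kpq))))
                       (h (proj₁ kpq))))
          (proj₂ δ i j)
        step3 : (j : I) → _⊑_ C (fun (fun f (∐ A α δ)) (fun g (α j))) u
        step3 j = ⊑-trans C _ _ _
          (cont f α δ (∐ (B ⟹ C) (λ i → fun f (α i)) fδ) (λ (i : I) → ∐-upper (B ⟹ C) (λ i → fun f (α i)) fδ i) (fun g (α j)))
          (∐-least C _ _ u (λ i → step4 i j))

    S2 : ContMap A (B ⟹ C) → ContMap (A ⟹ B) (A ⟹ C)
    S2 f = record
      { fun  = S3 f
      ; mono = λ g g' p x → mono (fun f x) _ _ (p x)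
      ; cont = λ β δ u h x → cont (fun f x) (λ j → fun (β j) x) (pointwise-dir A B β δ x) (fun u x) (λ j → h j x)
      }

    Sc : ContMap (A ⟹ B ⟹ C) ((A ⟹ B) ⟹ (A ⟹ C))
    Sc = record
      { fun  = S2
      ; mono = λ f f' p g x → p x (fun g x)
      ; cont = λ α δ u h g x → ∐-least C _ _ _ (λ i → h i g x)
      }

  module _ (D : DCPO⊥) where
    iter : ContMap D D → ℕ → Carrier D
    iter f zero    = ⊥ D
    iter f (suc n) = fun f (iter f n)

    iter-+ : (f : ContMap D D) (i j : ℕ) → _⊑_ D (iter f i) (iter f (i + j))
    iter-+ f zero    j = ⊥-least D _
    iter-+ f (suc i) j = mono f _ _ (iter-+ f i j)

    iter-dir : (f : ContMap D D) → isDirected (_⊑_ D) (iter f)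
    iter-dir f = ∣ zero ∣ , λ i j → ∣ i + j , iter-+ f i j ,
                   subst (λ k → _⊑_ D (iter f j) (iter f k)) (+-comm j i) (iter-+ f j i) ∣

    iter-le : (f g : ContMap D D) → _⊑_ (D ⟹ D) f g → (n : ℕ) → _⊑_ D (iter f n) (iter g n)
    iter-le f g p zero    = ⊑-refl D _
    iter-le f g p (suc n) = ⊑-trans D _ _ _ (mono f _ _ (iter-le f g p n)) (p (iter g n))

    lfp : ContMap D D → Carrier D
    lfp f = ∐ D (iter f) (iter-dir f)

    Fixc : ContMap (D ⟹ D) D
    Fixc = record
      { fun  = lfp
      ; mono = λ f g p → ∐-least D _ _ _ (λ n →
                 ⊑-trans D _ _ _ (iter-le f g p n) (∐-upper D _ (iter-dir g) n))
      ; cont = cont'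
      }
      where
      cont' : {I : Set} (α : I → ContMap D D) (δ : isDirected (_⊑_ (D ⟹ D)) α) (u : Carrier D) →
              ((i : I) → _⊑_ D (lfp (α i)) u) → _⊑_ D (lfp (∐ (D ⟹ D) α δ)) u
      cont' {I} α δ u h = ∐-least D _ _ _ (λ n → ⊑-trans D _ _ _ (claim n) (∐-least D _ (levδ n) u
                            (λ i → ⊑-trans D _ _ _ (∐-upper D _ (iter-dir (α i)) n) (h i))))
        where
        levδ : (n : ℕ) → isDirected (_⊑_ D) (λ i → iter (α i) n)
        levδ n = proj₁ δ , λ i j → ∥∥-map
          (λ kpq → proj₁ kpq , iter-le _ _ (proj₁ (proj₂ kpq)) n , iter-le _ _ (proj₂ (proj₂ kpq)) n)
          (proj₂ δ i j)
        claim : (n : ℕ) → _⊑_ D (iter (∐ (D ⟹ D) α δ) n) (∐ D (λ i → iter (α i) n) (levδ n))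
        claim zero    = ⊥-least D _
        claim (suc n) = ⊑-trans D _ _ _ (mono (∐ (D ⟹ D) α δ) _ _ (claim n))
          (∐-least D _ _ _ (λ i → cont (α i) (λ j → iter (α j) n) (levδ n) _ (λ j →
            ∥∥-rec (⊑-prop D _ _)
              (λ kpq → ⊑-trans D _ _ _ (proj₁ (proj₂ kpq) (iter (α j) n))
                (⊑-trans D _ _ _ (mono (α (proj₁ kpq)) _ _ (iter-le _ _ (proj₂ (proj₂ kpq)) n))
                  (∐-upper D _ (levδ (suc n)) (proj₁ kpq))))
              (proj₂ δ i j))))

  ⟦_⟧ : {σ : Ty} → Tm σ → Carrier ⟦ σ ⟧ᵗ
  ⟦ ZERO ⟧              = η zero
  ⟦ SUCC ⟧              = 𝓛mapC suc
  ⟦ PRED ⟧              = 𝓛mapC Data.Nat.pred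
  ⟦ IFZ ⟧               = IfzX
  ⟦ K {σ} {τ} ⟧         = Kc ⟦ σ ⟧ᵗ ⟦ τ ⟧ᵗ
  ⟦ S {σ} {τ} {ρ} ⟧     = Sc ⟦ σ ⟧ᵗ ⟦ τ ⟧ᵗ ⟦ ρ ⟧ᵗ
  ⟦ FIX {σ} ⟧           = Fixc ⟦ σ ⟧ᵗ
  ⟦ s · t ⟧             = fun ⟦ s ⟧ ⟦ t ⟧

{-# OPTIONS --safe #-}
module Submission where

open import Defs
open import Level using (Lift; lift; lower)
open import Data.Nat using (ℕ; zero; suc; pred; _≟_)
open import Data.Bool using (Bool; true)
open import Data.Maybe using (Maybe; just; nothing; map; _>>=_; _<∣>_; is-just)
open import Data.Maybe.Properties using (just-injective; ≡-dec)
open import Data.Product using (Σ; _×_; _,_; proj₁; proj₂)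
open import Data.Sum using (_⊎_)
open import Data.Unit using (tt)
open import Function using (_∘_)
open import Function.Bundles using (_⇔_; mk⇔; Equivalence)
open import Function.Construct.Symmetry using (⇔-sym)
open import Function.Construct.Composition using (_⇔-∘_)
open import Relation.Binary.Construct.Closure.ReflexiveTransitive using (Star; ε; _◅_; _◅◅_; gmap)
open import Relation.Nullary using (¬_; Dec; yes; no)
open import Relation.Nullary.Decidable using (toSum)
import Relation.Nullary.Decidable as Dec
open import Relation.Binary.PropositionalEquality using (_≡_; refl; sym; trans; cong; subst)

open Equivalence using (to; from)

-- Soundness: every reduction step preserves the denotation and ⟦ numeral n ⟧ = η n, so a term
-- reducing to a numeral is defined.  Adequacy: relate x : ⟦ σ ⟧ to t : Tm σ by "if x is defined
-- then t reduces to its value" at ι, and logically at arrow types.  The relation is closed under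
-- head expansion, contains ⊥ and is closed under directed suprema, hence under least fixed
-- points, so every term is related to its own denotation.  Decidability: one-step reduction is
-- the graph of a computable partial function `step`, so the k-step reduct of t is computable;
-- "the k-step reduct is a numeral" is then a semidecider for definedness.

iterate : ∀ {ℓ} {A : Set ℓ} → (A → Maybe A) → ℕ → A → Maybe A
iterate f zero    x = just x
iterate f (suc k) x = f x >>= iterate f k

module _ {ℓ} {A : Set ℓ} {R : A → A → Set ℓ} where

  iterRel→Star : ∀ k {x y} → iterRel R k x y → Star R x y
  iterRel→Star zero    refl          = ε
  iterRel→Star (suc k) (_ , r , rs) = r ◅ iterRel→Star k rs

  Star→iterRel : ∀ {x y} → Star R x y → Σ ℕ λ k → iterRel R k x y
  Star→iterRel ε        = zero , refl
  Star→iterRel (r ◅ rs) = let k , p = Star→iterRel rs in suc k , _ , r , p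

  iterRel-map : ∀ {S : A → A → Set ℓ} → (∀ {x y} → R x y → S x y) →
                ∀ k {x y} → iterRel R k x y → iterRel S k x y
  iterRel-map f zero    refl          = refl
  iterRel-map f (suc k) (y , r , rs) = y , f r , iterRel-map f k rs

  iterRel⇔iterate : (f : A → Maybe A) → (∀ {x y} → R x y ⇔ (f x ≡ just y)) →
                    ∀ k {x y} → iterRel R k x y ⇔ (iterate f k x ≡ just y)
  iterRel⇔iterate f graph k = mk⇔ (forward k) (backward k)
    where
    forward : ∀ k {x y} → iterRel R k x y → iterate f k x ≡ just y
    forward zero    refl = refl
    forward (suc k) (y , r , rs) rewrite to graph r = forward k rs
    backward : ∀ k {x y} → iterate f k x ≡ just y → iterRel R k x y
    backward zero    e = just-injective e
    backward (suc k) {x} e with f x in fx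
    ... | just y = y , from graph fx , backward k e

infix 4 _⇝*_
_⇝*_ : {σ : Ty} → Tm σ → Tm σ → Set
_⇝*_ = Star _⇝ᵢ_

isNumeral : Tm ι → Maybe ℕ
isNumeral ZERO       = just zero
isNumeral (SUCC · a) = map suc (isNumeral a)
isNumeral _          = nothing

isNumeral-numeral : ∀ n → isNumeral (numeral n) ≡ just n
isNumeral-numeral zero    = refl
isNumeral-numeral (suc n) rewrite isNumeral-numeral n = refl

isNumeral-sound : ∀ a {n} → isNumeral a ≡ just n → numeral n ≡ a
isNumeral-sound ZERO       refl = refl
isNumeral-sound (SUCC · a) e with isNumeral a in ea
isNumeral-sound (SUCC · a) refl | just n = cong (SUCC ·_) (isNumeral-sound a ea)

ifzero : {A : Set} → A → A → ℕ → A
ifzero x y zero    = x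
ifzero x y (suc _) = y

pred-numeral : ∀ n → PRED · numeral n ⇝ᵢ numeral (pred n)
pred-numeral zero    = pred-zero
pred-numeral (suc n) = pred-suc n

ifz-numeral : ∀ r r' n → IFZ · r · r' · numeral n ⇝ᵢ ifzero r r' n
ifz-numeral r r' zero    = ifz-zero r r'
ifz-numeral r r' (suc n) = ifz-suc r r' n

mutual
  step : {σ : Ty} → Tm σ → Maybe (Tm σ)
  step (f · a) = map (_· a) (step f) <∣> contract f a
  step _       = nothing

  contract : {σ τ : Ty} → Tm (σ ⇒ τ) → Tm σ → Maybe (Tm τ)
  contract SUCC            a = map (SUCC ·_) (step a)
  contract PRED            a = map (PRED ·_) (step a) <∣> map (numeral ∘ pred) (isNumeral a)
  contract (IFZ · r · r')  a = map (IFZ · r · r' ·_) (step a) <∣> map (ifzero r r') (isNumeral a)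
  contract (K · s)         a = just s
  contract (S · f · g)     a = just (f · a · (g · a))
  contract FIX             f = just (f · (FIX · f))
  contract _               _ = nothing

step-numeral : ∀ n → step (numeral n) ≡ nothing
step-numeral zero    = refl
step-numeral (suc n) rewrite step-numeral n = refl

step-complete : {σ : Ty} {s t : Tm σ} → s ⇝ᵢ t → step s ≡ just t
step-complete pred-zero                    = refl
step-complete (pred-suc n)      rewrite step-numeral (suc n) | isNumeral-numeral n = refl
step-complete (ifz-zero _ _)               = refl
step-complete (ifz-suc _ _ n)   rewrite step-numeral n | isNumeral-numeral n = refl
step-complete (k-β _ _)                    = refl
step-complete (s-β _ _ _)                  = refl
step-complete (fix-β _)                    = refl
step-complete (app-cong _ r)    rewrite step-complete r = refl
step-complete (succ-cong r)     rewrite step-complete r = refl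
step-complete (pred-cong r)     rewrite step-complete r = refl
step-complete (ifz-cong _ _ r)  rewrite step-complete r = refl

-- The common shape of the PRED and IFZ cases of `contract`.
congOrNumeral-sound : (C : Tm ι → Tm ι) (g : ℕ → Tm ι) →
                      (∀ {a a'} → a ⇝ᵢ a' → C a ⇝ᵢ C a') → (∀ n → C (numeral n) ⇝ᵢ g n) →
                      ∀ {a t} (m : Maybe (Tm ι)) → (∀ {a'} → m ≡ just a' → a ⇝ᵢ a') →
                      map C m <∣> map g (isNumeral a) ≡ just t → C a ⇝ᵢ t
congOrNumeral-sound C g cong-step redex (just a') sound refl = cong-step (sound refl)
congOrNumeral-sound C g cong-step redex {a} nothing sound e with isNumeral a in ea
congOrNumeral-sound C g cong-step redex {a} nothing sound refl | just n =
  subst (λ u → C u ⇝ᵢ g n) (isNumeral-sound a ea) (redex n)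

mutual
  step-sound : {σ : Ty} (s : Tm σ) {t : Tm σ} → step s ≡ just t → s ⇝ᵢ t
  step-sound (f · a) e with step f in ef
  step-sound (f · a) refl | just f' = app-cong a (step-sound f ef)
  step-sound (f · a) e    | nothing = contract-sound f a e

  contract-sound : {σ τ : Ty} (f : Tm (σ ⇒ τ)) (a : Tm σ) {t : Tm τ} →
                   contract f a ≡ just t → f · a ⇝ᵢ t
  contract-sound SUCC a e with step a in ea
  contract-sound SUCC a refl | just a' = succ-cong (step-sound a ea)
  contract-sound PRED a e =
    congOrNumeral-sound (PRED ·_) (numeral ∘ pred) pred-cong pred-numeral (step a) (step-sound a) e
  contract-sound (IFZ · r · r') a e =
    congOrNumeral-sound (IFZ · r · r' ·_) (ifzero r r') (ifz-cong r r') (ifz-numeral r r')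
                        (step a) (step-sound a) e
  contract-sound (K · s)     a refl = k-β s a
  contract-sound (S · f · g) a refl = s-β f g a
  contract-sound FIX         f refl = fix-β f

step-graph : {σ : Ty} {s t : Tm σ} → s ⇝ᵢ t ⇔ (step s ≡ just t)
step-graph = mk⇔ step-complete (step-sound _)

numeralAfter : ℕ → Tm ι → Maybe ℕ
numeralAfter k t = iterate step k t >>= isNumeral

iterRel⇔numeralAfter : ∀ k t n → iterRel _⇝ᵢ_ k t (numeral n) ⇔ (numeralAfter k t ≡ just n)
iterRel⇔numeralAfter k t n = mk⇔ forward backward
  where
  reducts = iterRel⇔iterate step step-graph k
  forward : iterRel _⇝ᵢ_ k t (numeral n) → numeralAfter k t ≡ just n
  forward p = trans (cong (_>>= isNumeral) (to reducts p)) (isNumeral-numeral n)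
  backward : numeralAfter k t ≡ just n → iterRel _⇝ᵢ_ k t (numeral n)
  backward e with iterate step k t in ek
  ... | just u = subst (iterRel _⇝ᵢ_ k t) (sym (isNumeral-sound u e)) (from reducts ek)

iterRel-numeral-dec : ∀ k t n → Dec (iterRel _⇝ᵢ_ k t (numeral n))
iterRel-numeral-dec k t n = Dec.map (⇔-sym (iterRel⇔numeralAfter k t n)) (≡-dec _≟_ _ _)

halts : Tm ι → ℕ → Bool
halts t k = is-just (numeralAfter k t)

halts⇔converges : ∀ t → Σ ℕ (λ k → halts t k ≡ true) ⇔ Σ ℕ (λ n → t ⇝* numeral n)
halts⇔converges t = mk⇔ forward backward
  where
  forward : Σ ℕ (λ k → halts t k ≡ true) → Σ ℕ (λ n → t ⇝* numeral n)
  forward (k , e) with numeralAfter k t in ek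
  ... | just n = n , iterRel→Star k (from (iterRel⇔numeralAfter k t n) ek)
  backward : Σ ℕ (λ n → t ⇝* numeral n) → Σ ℕ (λ k → halts t k ≡ true)
  backward (n , r) = let k , p = Star→iterRel r in
    k , cong is-just (to (iterRel⇔numeralAfter k t n) p)

module _ (pt : PropTrunc) where
  open PropTrunc pt

  ∥∥-cong : ∀ {a b} {A : Set a} {B : Set b} → A ⇔ B → ∥ A ∥ ⇔ ∥ B ∥
  ∥∥-cong e = mk⇔ (∥∥-rec ∥∥-isProp (∣_∣ ∘ to e)) (∥∥-rec ∥∥-isProp (∣_∣ ∘ from e))

  ∥∥-dec : ∀ {a} {A : Set a} → Dec A → Dec ∥ A ∥
  ∥∥-dec (yes a) = yes ∣ a ∣
  ∥∥-dec (no ¬a) = no (∥∥-rec (λ ()) ¬a)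

  module _ {ℓ} {A : Set ℓ} {R : A → A → Set ℓ} where

    iterRel-∥∥ : ∀ k {x y} → iterRel (λ u v → ∥ R u v ∥) k x y → ∥ iterRel R k x y ∥
    iterRel-∥∥ zero    refl          = ∣ refl ∣
    iterRel-∥∥ (suc k) (y , r , rs) =
      ∥∥-rec ∥∥-isProp (λ r' → ∥∥-rec ∥∥-isProp (λ p → ∣ y , r' , p ∣) (iterRel-∥∥ k rs)) r

    ∥iterRel∥⇔ : ∀ k {x y} → ∥ iterRel (λ u v → ∥ R u v ∥) k x y ∥ ⇔ ∥ iterRel R k x y ∥
    ∥iterRel∥⇔ k = mk⇔ (∥∥-rec ∥∥-isProp (iterRel-∥∥ k))
                       (∥∥-rec ∥∥-isProp (λ p → ∣ iterRel-map ∣_∣ k p ∣))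

module Semantics (pt : PropTrunc) (fe : FunExt) (pe : PropExt) where
  open Model pt fe pe
  open DCPO⊥
  open ContMap

  lfp-fixed : (D : DCPO⊥) (f : ContMap D D) → lfp D f ≡ fun f (lfp D f)
  lfp-fixed D f = ⊑-antisym D _ _
    (∐-least D _ _ _ iter-below)
    (cont f (iter D f) (iter-dir D f) (lfp D f) (λ n → ∐-upper D _ (iter-dir D f) (suc n)))
    where
    iter-below : ∀ n → _⊑_ D (iter D f n) (fun f (lfp D f))
    iter-below zero    = ⊥-least D _
    iter-below (suc n) = mono f _ _ (∐-upper D _ (iter-dir D f) n)

  ♯-η : {X Y : Set} (g : X → 𝓛 Y) (x : X) → (g ♯) (η x) ≡ g x
  ♯-η g x = 𝓛-ext ((g ♯) (η x)) (g x) proj₂ (tt ,_)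
                  (λ d e → cong (value (g x)) (isdefined-isProp (g x) _ e))

  ⟦numeral⟧ : ∀ n → ⟦ numeral n ⟧ ≡ η n
  ⟦numeral⟧ zero    = refl
  ⟦numeral⟧ (suc n) = cong (𝓛map suc) (⟦numeral⟧ n)

  ⟦⟧-⇝ᵢ : {σ : Ty} {s t : Tm σ} → s ⇝ᵢ t → ⟦ s ⟧ ≡ ⟦ t ⟧
  ⟦⟧-⇝ᵢ pred-zero         = refl
  ⟦⟧-⇝ᵢ (pred-suc n)      = trans (cong (𝓛map pred) (⟦numeral⟧ (suc n))) (sym (⟦numeral⟧ n))
  ⟦⟧-⇝ᵢ (ifz-zero s t)    = ♯-η (χ ⟦ s ⟧ ⟦ t ⟧) zero
  ⟦⟧-⇝ᵢ (ifz-suc s t n)   =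
    trans (cong (χ ⟦ s ⟧ ⟦ t ⟧ ♯) (⟦numeral⟧ (suc n))) (♯-η (χ ⟦ s ⟧ ⟦ t ⟧) (suc n))
  ⟦⟧-⇝ᵢ (k-β _ _)         = refl
  ⟦⟧-⇝ᵢ (s-β _ _ _)       = refl
  ⟦⟧-⇝ᵢ (fix-β {σ} f)     = lfp-fixed ⟦ σ ⟧ᵗ ⟦ f ⟧
  ⟦⟧-⇝ᵢ (app-cong t r)    = cong (λ h → fun h ⟦ t ⟧) (⟦⟧-⇝ᵢ r)
  ⟦⟧-⇝ᵢ (succ-cong r)     = cong (𝓛map suc) (⟦⟧-⇝ᵢ r)
  ⟦⟧-⇝ᵢ (pred-cong r)     = cong (𝓛map pred) (⟦⟧-⇝ᵢ r)
  ⟦⟧-⇝ᵢ (ifz-cong s t r)  = cong (χ ⟦ s ⟧ ⟦ t ⟧ ♯) (⟦⟧-⇝ᵢ r)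

  ⟦⟧-⇝* : {σ : Ty} {s t : Tm σ} → s ⇝* t → ⟦ s ⟧ ≡ ⟦ t ⟧
  ⟦⟧-⇝* ε        = refl
  ⟦⟧-⇝* (r ◅ rs) = trans (⟦⟧-⇝ᵢ r) (⟦⟧-⇝* rs)

  converges→defined : ∀ {t n} → t ⇝* numeral n → isdefined ⟦ t ⟧
  converges→defined {n = n} r = subst isdefined (sym (trans (⟦⟧-⇝* r) (⟦numeral⟧ n))) tt

  Approx : (σ : Ty) → Carrier ⟦ σ ⟧ᵗ → Tm σ → Set₁
  Approx ι       l t = Lift _ ((d : isdefined l) → ∥ t ⇝* numeral (value l d) ∥)
  Approx (σ ⇒ τ) f s = ∀ x t → Approx σ x t → Approx τ (fun f x) (s · t)

  Approx-expand : ∀ σ {x s s'} → s ⇝ᵢ s' → Approx σ x s' → Approx σ x s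
  Approx-expand ι       r a       = lift (λ d → ∥∥-map (r ◅_) (lower a d))
  Approx-expand (σ ⇒ τ) r a x t b = Approx-expand τ (app-cong t r) (a x t b)

  Approx-⊥ : ∀ σ t → Approx σ (⊥ ⟦ σ ⟧ᵗ) t
  Approx-⊥ ι       t       = lift (λ ())
  Approx-⊥ (σ ⇒ τ) t _ u _ = Approx-⊥ τ (t · u)

  Approx-∐ : ∀ σ {I : Set} (α : I → Carrier ⟦ σ ⟧ᵗ) (δ : isDirected (_⊑_ ⟦ σ ⟧ᵗ) α) t →
             (∀ i → Approx σ (α i) t) → Approx σ (∐ ⟦ σ ⟧ᵗ α δ) t
  Approx-∐ ι α δ t a = lift λ d → ∥∥-rec ∥∥-isProp (λ (i , dᵢ) →
    subst (λ v → ∥ t ⇝* numeral v ∥)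
          (value-cong (∐ₗ-upper α δ i dᵢ) dᵢ d) (lower (a i) dᵢ)) d
  Approx-∐ (σ ⇒ τ) α δ t a x u b =
    Approx-∐ τ (λ i → fun (α i) x) (pointwise-dir ⟦ σ ⟧ᵗ ⟦ τ ⟧ᵗ α δ x) (t · u) (λ i → a i x u b)

  Approx-lfp : ∀ σ f s → Approx (σ ⇒ σ) f s → Approx σ (lfp ⟦ σ ⟧ᵗ f) (FIX · s)
  Approx-lfp σ f s a = Approx-∐ σ (iter ⟦ σ ⟧ᵗ f) (iter-dir ⟦ σ ⟧ᵗ f) (FIX · s) Approx-iter
    where
    Approx-iter : ∀ n → Approx σ (iter ⟦ σ ⟧ᵗ f n) (FIX · s)
    Approx-iter zero    = Approx-⊥ σ (FIX · s)
    Approx-iter (suc n) = Approx-expand σ (fix-β s) (a _ (FIX · s) (Approx-iter n))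

  Approx-χ : ∀ {x y s s'} → Approx ι x s → Approx ι y s' →
             ∀ n → Approx ι (χ x y n) (IFZ · s · s' · numeral n)
  Approx-χ {x = x} {s = s} {s'} a b zero    = Approx-expand ι {x} (ifz-zero s s') a
  Approx-χ {y = y} {s = s} {s'} a b (suc n) = Approx-expand ι {y} (ifz-suc s s' n) b

  fundamental : {σ : Ty} (t : Tm σ) → Approx σ ⟦ t ⟧ t
  fundamental ZERO = lift (λ _ → ∣ ε ∣)
  fundamental SUCC _ _ a = lift (λ d → ∥∥-map (gmap (SUCC ·_) succ-cong) (lower a d))
  fundamental PRED x _ a = lift (λ d →
    ∥∥-map (λ r → gmap (PRED ·_) pred-cong r ◅◅ pred-numeral (value x d) ◅ ε) (lower a d))
  fundamental IFZ _ s a _ s' b z _ c = lift λ (d , dχ) →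
    ∥∥-rec ∥∥-isProp
      (λ r → ∥∥-map (gmap (IFZ · s · s' ·_) (ifz-cong s s') r ◅◅_)
                    (lower (Approx-χ a b (value z d)) dχ))
      (lower c d)
  fundamental K _ s a _ t _ = Approx-expand _ (k-β s t) a
  fundamental S _ r a g s b x t c = Approx-expand _ (s-β r s t) (a x t c (fun g x) (s · t) (b x t c))
  fundamental (FIX {σ}) = Approx-lfp σ
  fundamental (s · t) = fundamental s ⟦ t ⟧ t (fundamental t)

  adequacy : (t : Tm ι) (d : isdefined ⟦ t ⟧) → ∥ t ⇝* numeral (value ⟦ t ⟧ d) ∥
  adequacy t = lower (fundamental t)

  defined⇔converges : (t : Tm ι) → isdefined ⟦ t ⟧ ⇔ ∥ Σ ℕ (λ n → t ⇝* numeral n) ∥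
  defined⇔converges t = mk⇔ (λ d → ∥∥-map (value ⟦ t ⟧ d ,_) (adequacy t d))
                            (∥∥-rec (isdefined-isProp ⟦ t ⟧) (converges→defined ∘ proj₂))

  converges⇔∃⇝^ : (t : Tm ι) →
    ∥ Σ ℕ (λ n → t ⇝* numeral n) ∥ ⇔ ∃ᵗ (λ n → ∃ᵗ (λ k → (_⇝_ ^ k) t (numeral n)))
  converges⇔∃⇝^ t = mk⇔
    (∥∥-map λ (n , r) → let k , p = Star→iterRel r in n , ∣ k , from (∥iterRel∥⇔ pt k) ∣ p ∣ ∣)
    (∥∥-rec ∥∥-isProp λ (n , e) → ∥∥-rec ∥∥-isProp
      (λ (k , q) → ∥∥-map (λ p → n , iterRel→Star k p) (to (∥iterRel∥⇔ pt k) q)) e)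

theorem8p3 : (pt : PropTrunc) (fe : FunExt) (pe : PropExt) (t : Tm ι) →
    let open Model pt fe pe in
      (isdefined ⟦ t ⟧ ⇔ ∃ᵗ (λ (n : ℕ) → ∃ᵗ (λ (k : ℕ) → (_⇝_ ^ k) t (numeral n))))
      × ((n k : ℕ) → (_⇝_ ^ k) t (numeral n) ⊎ ¬ (_⇝_ ^ k) t (numeral n))
      × isSemidecidable (isdefined ⟦ t ⟧)
theorem8p3 pt fe pe t =
    converges⇔∃⇝^ t ⇔-∘ defined⇔converges t
  , (λ n k → toSum (Dec.map (⇔-sym (∥iterRel∥⇔ pt k)) (∥∥-dec pt (iterRel-numeral-dec k t n))))
  , ∣ halts t , ∥∥-cong pt (⇔-sym (halts⇔converges t)) ⇔-∘ defined⇔converges t ∣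
  where
  open PropTrunc pt
  open Semantics pt fe pe
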